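{- Let $\mathcal{G}=(G,\lambda)$ be a simple temporal clique and let $G^-=(V,E^-)$ be the digraph defined below. For every directed path $(u_0,u_1),(u_1,u_2),\dots,(u_{k-1},u_k)$ in $G^-$ ($k\ge1$, vertices pairwise distinct), the sequence of edges $\{u_0,u_1\},\dots,\{u_{k-1},u_k\}$ is a journey from $u_0$ to $u_k$ in $\mathcal{G}$.
   Context: A simple temporal clique is a pair $\mathcal{G}=(G,\lambda)$ where $G=(V,E)$ is the complete graph on a finite vertex set $V$ with $|V|\ge 2$, and $\lambda:E\to\mathbb{N}$ assigns to each edge a single label such that any two distinct edges sharing an endpoint have distinct labels. A journey is a sequence of edges $\{u_1,u_2\},\dots,\{u_k,u_{k+1}\}$ with the $u_i$ pairwise distinct and strictly increasing labels along the sequence. For a vertex $v$, $e^-(v)$ denotes the edge incident to $v$ with the smallest label. The digraph $G^-=(V,E^-)$ has, for each vertex $v$ with $e^-(v)=\{u,v\}$, the arc $(u,v)$, except that whenever $e^-(u)=e^-(v)$ for two vertices $u,v$, only one of the arcs $(u,v)$, $(v,u)$ is included (chosen arbitrarily). -}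

module Defs where

open import Data.Nat using (ℕ; _<_; _≤_)
open import Data.Fin using (Fin)
open import Data.List using (List; []; _∷_; length)
open import Data.List.Relation.Unary.Unique.Propositional using (Unique)
open import Data.List.Relation.Unary.Linked using (Linked)
open import Data.Product using (_×_)
open import Data.Sum using (_⊎_)
open import Data.Unit using (⊤)
open import Relation.Nullary using (¬_)
open import Relation.Binary.PropositionalEquality using (_≡_; _≢_)

-- Vertex set V = Fin n.  A labelling of the complete graph is a function
-- λ : V → V → ℕ, where λ u v is the label of the edge {u,v} (u ≢ v);
-- values on the diagonal are irrelevant.
Labelling : ℕ → Set
Labelling n = Fin n → Fin n → ℕ

IsSimpleTemporalClique : {n : ℕ} → Labelling n → Set
IsSimpleTemporalClique {n} lab =
  (2 ≤ n) ×
  ((u v : Fin n) → u ≢ v → lab u v ≡ lab v u) ×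
  ((u v w : Fin n) → u ≢ v → u ≢ w → v ≢ w → lab u v ≢ lab u w)

-- MinNbr lab v u : e⁻(v) = {u,v}, i.e. {v,u} is the edge incident to v
-- with the smallest label.
MinNbr : {n : ℕ} → Labelling n → Fin n → Fin n → Set
MinNbr {n} lab v u = (u ≢ v) × ((w : Fin n) → w ≢ v → lab v u ≤ lab v w)

IsGMinus : {n : ℕ} → Labelling n → (Fin n → Fin n → Set) → Set
IsGMinus {n} lab A =
  ((u v : Fin n) → A u v → MinNbr lab v u) ×
  ((u v : Fin n) → MinNbr lab v u → ¬ MinNbr lab u v → A u v) ×
  ((u v : Fin n) → MinNbr lab v u → MinNbr lab u v →
     (A u v ⊎ A v u) × ¬ (A u v × A v u))

IsDirectedPath : {n : ℕ} → (Fin n → Fin n → Set) → List (Fin n) → Set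
IsDirectedPath A us = (2 ≤ length us) × Unique us × Linked A us

LabelsIncreasing : {n : ℕ} → Labelling n → List (Fin n) → Set
LabelsIncreasing lab [] = ⊤
LabelsIncreasing lab (x ∷ []) = ⊤
LabelsIncreasing lab (x ∷ y ∷ []) = ⊤
LabelsIncreasing lab (x ∷ y ∷ z ∷ rest) =
  (lab x y < lab y z) × LabelsIncreasing lab (y ∷ z ∷ rest)

IsJourney : {n : ℕ} → Labelling n → List (Fin n) → Set
IsJourney lab us = (2 ≤ length us) × Unique us × LabelsIncreasing lab us

-- Every arc (u,v) of G⁻ carries the smallest label at v, so for consecutive
-- arcs (x,y),(y,z) the label of {x,y} is at most that of {y,z}; local
-- injectivity at y makes the inequality strict.
module Submission where

open import Defs
open import Data.Nat using (ℕ; _<_)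
open import Data.Nat.Properties using (≤∧≢⇒<)
open import Data.Fin using (Fin)
open import Data.List using (List; []; _∷_)
open import Data.List.Relation.Unary.All using (_∷_)
open import Data.List.Relation.Unary.AllPairs using (AllPairs; _∷_)
open import Data.List.Relation.Unary.Linked using (Linked; _∷_)
open import Data.Product using (_,_)
open import Data.Unit using (tt)
open import Relation.Binary.PropositionalEquality using (_≢_; ≢-sym; subst)

minNbr⇒label-< : ∀ {n} {lab : Labelling n} → IsSimpleTemporalClique lab →
  ∀ {x y z} → MinNbr lab y x → x ≢ z → y ≢ z → lab x y < lab y z
minNbr⇒label-< {lab = lab} (_ , symmetric , locallyInjective) {x} {y} {z}
  (x≢y , minimal) x≢z y≢z =
  subst (_< lab y z) (symmetric y x (≢-sym x≢y))
    (≤∧≢⇒< (minimal z (≢-sym y≢z)) (locallyInjective y x z (≢-sym x≢y) y≢z x≢z))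

labelsIncreasing-minNbrPath : ∀ {n} {lab : Labelling n} → IsSimpleTemporalClique lab →
  {A : Fin n → Fin n → Set} → (∀ {u v} → A u v → MinNbr lab v u) →
  (us : List (Fin n)) → AllPairs _≢_ us → Linked A us → LabelsIncreasing lab us
labelsIncreasing-minNbrPath clique arc⇒minNbr [] _ _ = tt
labelsIncreasing-minNbrPath clique arc⇒minNbr (_ ∷ []) _ _ = tt
labelsIncreasing-minNbrPath clique arc⇒minNbr (_ ∷ _ ∷ []) _ _ = tt
labelsIncreasing-minNbrPath clique arc⇒minNbr (x ∷ y ∷ z ∷ rest)
  ((_ ∷ x≢z ∷ _) ∷ distinct@((y≢z ∷ _) ∷ _)) (xy ∷ linked@(_ ∷ _)) =
  minNbr⇒label-< clique (arc⇒minNbr xy) x≢z y≢z ,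
  labelsIncreasing-minNbrPath clique arc⇒minNbr (y ∷ z ∷ rest) distinct linked

lemma2 : (n : ℕ) (lab : Labelling n) → IsSimpleTemporalClique lab →
    (A : Fin n → Fin n → Set) → IsGMinus lab A →
    (us : List (Fin n)) → IsDirectedPath A us → IsJourney lab us
lemma2 n lab clique A (arc⇒minNbr , _) us (long , distinct , linked) =
  long , distinct ,
  labelsIncreasing-minNbrPath clique (arc⇒minNbr _ _) us distinct linked
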